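{- Let $p\le q$ and let $(K_{p,q},\sigma)$ be a signed complete bipartite graph with bipartition $(U_p,V_q)$, $U_p=\{u_1,\dots,u_p\}$, $V_q=\{v_1,\dots,v_q\}$. Let $U_r\subseteq U_p$ and $V_s\subseteq V_q$ with $|U_r|=r\le p$, $|V_s|=s\le q$ be such that the induced signed subgraph $(K_{p,q},\sigma)[U_r\cup V_s]$ contains all negative edges of $(K_{p,q},\sigma)$, and such that $r+s$ is minimum among all vertex sets of this form with this property. Then the multiplicity $m(0)$ of the eigenvalue $0$ of $(K_{p,q},\sigma)$ satisfies $m(0)\ge p+q-2k-2$, where $k=\min(r,s)$.
   Context: A signed graph $\Gamma=(G,\sigma)$ consists of a simple graph $G$ and a sign function $\sigma:E(G)\to\{ -1,1\}$; edges with sign $-1$ are negative, those with sign $+1$ positive. Its adjacency matrix $A(\Gamma)=(a^\sigma_{ij})$ has $a^\sigma_{ij}=\sigma(v_iv_j)$ if $v_iv_j\in E(G)$ and $0$ otherwise. The eigenvalues (spectrum) of $\Gamma$ are those of $A(\Gamma)$, counted with multiplicity; $m(\lambda)$ denotes the multiplicity of eigenvalue $\lambda$. For $X\subseteq V(G)$, $\Gamma[X]$ is the induced signed subgraph on $X$ with the restricted sign function. $K_{p,q}$ is the complete bipartite graph with parts of sizes $p$ and $q$. -}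

module Defs where

open import Data.Nat as ℕ using (ℕ; zero; suc)
open import Data.Integer as ℤ using (ℤ; +_; -_; -[1+_])
open import Data.Fin as Fin using (Fin; splitAt; punchIn)
open import Data.Fin.Subset using (Subset; _∈_; ∣_∣)
open import Data.Sum using (_⊎_; inj₁; inj₂)
open import Data.Product using (_×_)
open import Data.List using (List; []; _∷_; map; foldr; allFin)
open import Data.Bool using (if_then_else_)
open import Relation.Nullary using (does)
open import Relation.Binary.PropositionalEquality using (_≡_)

-- Polynomials with integer coefficients, as coefficient lists
-- (lowest degree first; trailing zeros allowed).

Poly : Set
Poly = List ℤ

_+ₚ_ : Poly → Poly → Poly
[] +ₚ q = q
(a ∷ p) +ₚ [] = a ∷ p
(a ∷ p) +ₚ (b ∷ q) = (a ℤ.+ b) ∷ (p +ₚ q)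

scaleₚ : ℤ → Poly → Poly
scaleₚ c p = map (c ℤ.*_) p

_*ₚ_ : Poly → Poly → Poly
[] *ₚ q = []
(a ∷ p) *ₚ q = scaleₚ a q +ₚ (+ 0 ∷ (p *ₚ q))

altSign : ℕ → ℤ
altSign zero = + 1
altSign (suc zero) = -[1+ 0 ]
altSign (suc (suc k)) = altSign k

det : ∀ n → (Fin n → Fin n → Poly) → Poly
det zero M = + 1 ∷ []
det (suc n) M =
  foldr _+ₚ_ []
    (map (λ j → scaleₚ (altSign (Fin.toℕ j))
                       (M Fin.zero j *ₚ det n (λ i k → M (Fin.suc i) (punchIn j k))))
         (allFin (suc n)))

charPoly : ∀ n → (Fin n → Fin n → ℤ) → Poly
charPoly n A = det n (λ i j →
  if does (i Fin.≟ j) then (- A i j) ∷ + 1 ∷ [] else (- A i j) ∷ [])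

-- Multiplicity of 0 as a root of a polynomial: number of initial
-- zero coefficients (the largest N with x^N dividing it; applied only to
-- monic, hence nonzero, characteristic polynomials).
mult0 : Poly → ℕ
mult0 [] = 0
mult0 (a ∷ p) = if does (a ℤ.≟ + 0) then suc (mult0 p) else 0

-- Multiplicity of eigenvalue 0 of an integer n×n matrix
-- (algebraic multiplicity = multiplicity as root of characteristic polynomial).
eigMult0 : ∀ n → (Fin n → Fin n → ℤ) → ℕ
eigMult0 n A = mult0 (charPoly n A)

data Sign : Set where
  pos neg : Sign

signVal : Sign → ℤ
signVal pos = + 1
signVal neg = -[1+ 0 ]

SignedKpq : ℕ → ℕ → Set
SignedKpq p q = Fin p → Fin q → Sign

-- Vertices: Fin (p + q); the first p are U_p = {u_1..u_p}, the rest V_q.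
adjBip : ∀ {p q} → SignedKpq p q → Fin p ⊎ Fin q → Fin p ⊎ Fin q → ℤ
adjBip σ (inj₁ a) (inj₂ b) = signVal (σ a b)
adjBip σ (inj₂ b) (inj₁ a) = signVal (σ a b)
adjBip σ (inj₁ _) (inj₁ _) = + 0
adjBip σ (inj₂ _) (inj₂ _) = + 0

adjacency : ∀ {p q} → SignedKpq p q → Fin (p ℕ.+ q) → Fin (p ℕ.+ q) → ℤ
adjacency {p} {q} σ i j = adjBip σ (splitAt p i) (splitAt p j)

ContainsAllNeg : ∀ {p q} → SignedKpq p q → Subset p → Subset q → Set
ContainsAllNeg {p} {q} σ Ur Vs =
  (a : Fin p) (b : Fin q) → σ a b ≡ neg → (a ∈ Ur) × (b ∈ Vs)

{-# OPTIONS --safe #-}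
module Submission where

-- The adjacency matrix of a signed K_{p,q} is [[0, S], [Sᵀ, 0]] for the sign
-- matrix S = J − 2N, where N marks the negative edges. As N vanishes outside
-- the rows Ur and outside the columns Vs, S is a sum of 1 + min(r, s) rank-one
-- matrices, so A is a sum of ρ = 2(k + 1) of them. For such A, x^(n − ρ)
-- divides det(xI − A): expand the determinant multilinearly column by column;
-- every column contributes either x·e_j or one of the ρ rank-one directions,
-- and a direction chosen twice produces two proportional columns.

open import Algebra using (CommutativeRing)
import Algebra.Properties.CommutativeSemigroup
open import Data.Bool using (Bool; true; false; if_then_else_)
open import Data.Fin as Fin using (Fin; zero; suc; punchIn; punchOut; inject₁; toℕ; splitAt)
open import Data.Fin.Properties
  using (_≟_; punchInᵢ≢i; punchIn-punchOut; punchIn-injective; toℕ-inject₁; toℕ-injective; toℕ-fromℕ<; <-cmp)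
open import Data.Fin.Subset using (Subset; _∉_; ∣_∣)
open import Data.Nat as ℕ using (ℕ; zero; suc; _∸_)
import Data.Nat.Properties as ℕ
open import Data.Product using (Σ-syntax; ∃-syntax; _×_; _,_; proj₁; proj₂)
open import Data.Sum as Sum using (_⊎_; inj₁; inj₂; [_,_]′)
open import Data.Vec using (_∷_; there)
open import Data.Vec.Functional using (updateAt)
open import Data.Vec.Functional.Properties using (updateAt-updates; updateAt-minimal)
open import Function using (const; id; _∘_)
open import Level using (0ℓ; _⊔_)
open import Relation.Binary.Definitions using (tri<; tri≈; tri>)
open import Relation.Binary.PropositionalEquality as ≡ using (_≡_; _≢_)
open import Relation.Nullary using (yes; no; does)
open import Relation.Nullary.Decidable using (dec-no)
open import Relation.Nullary.Negation using (contradiction)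

punchIn-inject₁-self : ∀ {n} (a : Fin n) → punchIn (inject₁ a) a ≡ suc a
punchIn-inject₁-self zero = ≡.refl
punchIn-inject₁-self (suc a) = ≡.cong suc (punchIn-inject₁-self a)

punchIn-adjacent : ∀ {n} (a k : Fin n) →
  punchIn (inject₁ a) k ≡ punchIn (suc a) k ⊎ (punchIn (inject₁ a) k ≡ suc a × punchIn (suc a) k ≡ inject₁ a)
punchIn-adjacent zero zero = inj₂ (≡.refl , ≡.refl)
punchIn-adjacent zero (suc k) = inj₁ ≡.refl
punchIn-adjacent (suc a) zero = inj₁ ≡.refl
punchIn-adjacent (suc a) (suc k) with punchIn-adjacent a k
... | inj₁ e = inj₁ (≡.cong suc e)
... | inj₂ (e , e′) = inj₂ (≡.cong suc e , ≡.cong suc e′)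

punchIn-adjacentPair : ∀ {n} (j : Fin (suc (suc n))) (a : Fin (suc n)) → j ≢ inject₁ a → j ≢ suc a →
  ∃[ a′ ] punchIn j (inject₁ a′) ≡ inject₁ a × punchIn j (suc a′) ≡ suc a
punchIn-adjacentPair zero zero j≢a _ = contradiction ≡.refl j≢a
punchIn-adjacentPair zero (suc a) _ _ = a , ≡.refl , ≡.refl
punchIn-adjacentPair (suc zero) zero _ j≢a+1 = contradiction ≡.refl j≢a+1
punchIn-adjacentPair {suc n} (suc (suc j)) zero _ _ = zero , ≡.refl , ≡.refl
punchIn-adjacentPair {suc n} (suc j) (suc a) j≢a j≢a+1
  with punchIn-adjacentPair j a (j≢a ∘ ≡.cong suc) (j≢a+1 ∘ ≡.cong suc)
... | a′ , e , e′ = suc a′ , ≡.cong suc e , ≡.cong suc e′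

inject₁≢suc : ∀ {n} (a : Fin n) → inject₁ a ≢ suc a
inject₁≢suc a e = punchInᵢ≢i (inject₁ a) a (≡.trans (punchIn-inject₁-self a) (≡.sym e))

[1+m]∸n≤1+[m∸n] : ∀ m n → suc m ∸ n ℕ.≤ suc (m ∸ n)
[1+m]∸n≤1+[m∸n] m zero = ℕ.≤-refl
[1+m]∸n≤1+[m∸n] zero (suc n) = ℕ.≤-trans (ℕ.m∸n≤m 0 n) ℕ.z≤n
[1+m]∸n≤1+[m∸n] (suc m) (suc n) = [1+m]∸n≤1+[m∸n] m n

module LinearAlgebra {c ℓ} (R : CommutativeRing c ℓ) where

  open CommutativeRing R hiding (zero)
  open import Algebra.Properties.Ring ring using (-‿involutive; -0#≈0#; +-inverseʳ-unique; -‿distribˡ-*)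
  open import Algebra.Properties.Semiring.Sum semiring
    using (sum; sum-syntax; sum-cong-≋; sum-remove; ∑-distrib-+; *-distribˡ-sum; sum-replicate-zero)
  open import Algebra.Properties.CommutativeSemigroup *-commutativeSemigroup using (x∙yz≈y∙xz)
  module +-Comm = Algebra.Properties.CommutativeSemigroup +-commutativeSemigroup
  open import Algebra.Properties.Semiring.Divisibility semiring
    using (_∣_; _,_; _∣0; ε∣ʳ_; ∣ʳ-trans; ∣ʳ-respʳ-≈; x∣ʳy⇒x∣ʳzy)
  open import Algebra.Properties.Semiring.Exp semiring using (_^_; ^-congʳ; ^-homo-*)
  open import Relation.Binary.Reasoning.Setoid setoid

  sum-≈0 : ∀ {n} (f : Fin n → Carrier) → (∀ i → f i ≈ 0#) → sum f ≈ 0#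
  sum-≈0 {n} f f≈0 = trans (sum-cong-≋ {x = f} f≈0) (sum-replicate-zero n)

  Matrix : ℕ → Set c
  Matrix n = Fin n → Fin n → Carrier

  sgn : ℕ → Carrier
  sgn zero = 1#
  sgn (suc zero) = - 1#
  sgn (suc (suc k)) = sgn k

  sgn-suc : ∀ k → sgn (suc k) ≈ - sgn k
  sgn-suc zero = refl
  sgn-suc (suc zero) = sym (-‿involutive 1#)
  sgn-suc (suc (suc k)) = sgn-suc k

  minor : ∀ {n} → Fin (suc n) → Matrix (suc n) → Matrix n
  minor j M i k = M (suc i) (punchIn j k)

  det : ∀ {n} → Matrix n → Carrier
  expansionTerm : ∀ {n} → Matrix (suc n) → Fin (suc n) → Carrier

  det {zero} M = 1#
  det {suc n} M = sum (expansionTerm M)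
  expansionTerm M j = sgn (toℕ j) * (M zero j * det (minor j M))

  _≋ₘ_ : ∀ {n} → Matrix n → Matrix n → Set ℓ
  M ≋ₘ N = ∀ i j → M i j ≈ N i j

  det-cong : ∀ {n} {M N : Matrix n} → M ≋ₘ N → det M ≈ det N
  det-cong {zero} M≋N = refl
  det-cong {suc n} {M} {N} M≋N = sum-cong-≋ {x = expansionTerm M} {y = expansionTerm N} λ j →
    *-congˡ (*-cong (M≋N zero j) (det-cong λ i k → M≋N (suc i) (punchIn j k)))

  AgreeOffColumn : ∀ {n} → Fin n → Matrix n → Matrix n → Set ℓ
  AgreeOffColumn c M N = ∀ i j → j ≢ c → M i j ≈ N i j

  module _ {n} {c : Fin (suc n)} {M N : Matrix (suc n)} (M≈N : AgreeOffColumn c M N) where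

    minor-agreeOnColumn : minor c M ≋ₘ minor c N
    minor-agreeOnColumn i k = M≈N (suc i) (punchIn c k) (punchInᵢ≢i c k)

    minor-agreeOffColumn : ∀ {j} (j≢c : j ≢ c) → AgreeOffColumn (punchOut j≢c) (minor j M) (minor j N)
    minor-agreeOffColumn {j} j≢c i k k≢c′ = M≈N (suc i) (punchIn j k) λ e →
      k≢c′ (punchIn-injective j k _ (≡.trans e (≡.sym (punchIn-punchOut j≢c))))

  minor-column : ∀ {n} {j c : Fin (suc n)} (M : Matrix (suc n)) (j≢c : j ≢ c) i →
                 minor j M i (punchOut j≢c) ≡ M (suc i) c
  minor-column M j≢c i = ≡.cong (M (suc i)) (punchIn-punchOut j≢c)

  *-distribˡ-+₃ : ∀ s a x y → s * (a * (x + y)) ≈ s * (a * x) + s * (a * y)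
  *-distribˡ-+₃ s a x y = trans (*-congˡ (distribˡ a x y)) (distribˡ s _ _)

  *-distribʳ-+₃ : ∀ s a b d → s * ((a + b) * d) ≈ s * (a * d) + s * (b * d)
  *-distribʳ-+₃ s a b d = trans (*-congˡ (distribʳ d a b)) (distribˡ s _ _)

  det-+-column : ∀ {n} (c : Fin n) {M N N′ : Matrix n} →
                 AgreeOffColumn c M N → AgreeOffColumn c M N′ →
                 (∀ i → M i c ≈ N i c + N′ i c) → det M ≈ det N + det N′
  det-+-column {suc n} c {M} {N} {N′} M≈N M≈N′ M≈N+N′ =
    trans (sum-cong-≋ {x = expansionTerm M} term) (∑-distrib-+ (expansionTerm N) (expansionTerm N′))
    where
    term : ∀ j → expansionTerm M j ≈ expansionTerm N j + expansionTerm N′ j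
    term j with j ≟ c
    ... | yes ≡.refl = begin
      sgn (toℕ j) * (M zero j * det (minor j M))
        ≈⟨ *-congˡ (*-cong (M≈N+N′ zero) (det-cong (minor-agreeOnColumn M≈N))) ⟩
      sgn (toℕ j) * ((N zero j + N′ zero j) * det (minor j N))
        ≈⟨ *-distribʳ-+₃ _ _ _ _ ⟩
      expansionTerm N j + sgn (toℕ j) * (N′ zero j * det (minor j N))
        ≈⟨ +-congˡ (*-congˡ (*-congˡ (det-cong λ i k →
             trans (sym (minor-agreeOnColumn M≈N i k)) (minor-agreeOnColumn M≈N′ i k)))) ⟩
      expansionTerm N j + expansionTerm N′ j ∎
    ... | no j≢c = begin
      sgn (toℕ j) * (M zero j * det (minor j M))
        ≈⟨ *-congˡ (*-congˡ minors) ⟩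
      sgn (toℕ j) * (M zero j * (det (minor j N) + det (minor j N′)))
        ≈⟨ *-distribˡ-+₃ _ _ _ _ ⟩
      sgn (toℕ j) * (M zero j * det (minor j N)) + sgn (toℕ j) * (M zero j * det (minor j N′))
        ≈⟨ +-cong (*-congˡ (*-congʳ (M≈N zero j j≢c))) (*-congˡ (*-congʳ (M≈N′ zero j j≢c))) ⟩
      expansionTerm N j + expansionTerm N′ j ∎
      where
      minors : det (minor j M) ≈ det (minor j N) + det (minor j N′)
      minors = det-+-column (punchOut j≢c)
        (minor-agreeOffColumn M≈N j≢c) (minor-agreeOffColumn M≈N′ j≢c) λ i → begin
          minor j M i (punchOut j≢c) ≡⟨ minor-column M j≢c i ⟩
          M (suc i) c ≈⟨ M≈N+N′ (suc i) ⟩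
          N (suc i) c + N′ (suc i) c ≡⟨ ≡.sym (≡.cong₂ _+_ (minor-column N j≢c i) (minor-column N′ j≢c i)) ⟩
          minor j N i (punchOut j≢c) + minor j N′ i (punchOut j≢c) ∎

  *-rotate : ∀ s r b d → s * ((r * b) * d) ≈ r * (s * (b * d))
  *-rotate s r b d = begin
    s * ((r * b) * d) ≈⟨ *-congˡ (*-assoc r b d) ⟩
    s * (r * (b * d)) ≈⟨ x∙yz≈y∙xz s r _ ⟩
    r * (s * (b * d)) ∎

  det-*-column : ∀ {n} (c : Fin n) r {M N : Matrix n} →
                 AgreeOffColumn c M N → (∀ i → M i c ≈ r * N i c) → det M ≈ r * det N
  det-*-column {suc n} c r {M} {N} M≈N M≈rN =
    trans (sum-cong-≋ {x = expansionTerm M} term) (sym (*-distribˡ-sum r (expansionTerm N)))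
    where
    term : ∀ j → expansionTerm M j ≈ r * expansionTerm N j
    term j with j ≟ c
    ... | yes ≡.refl = begin
      sgn (toℕ j) * (M zero j * det (minor j M))
        ≈⟨ *-congˡ (*-cong (M≈rN zero) (det-cong (minor-agreeOnColumn M≈N))) ⟩
      sgn (toℕ j) * ((r * N zero j) * det (minor j N)) ≈⟨ *-rotate _ _ _ _ ⟩
      r * expansionTerm N j ∎
    ... | no j≢c = begin
      sgn (toℕ j) * (M zero j * det (minor j M))
        ≈⟨ *-congˡ (*-cong (M≈N zero j j≢c) minors) ⟩
      sgn (toℕ j) * (N zero j * (r * det (minor j N))) ≈⟨ *-congˡ (x∙yz≈y∙xz _ r _) ⟩
      sgn (toℕ j) * (r * (N zero j * det (minor j N))) ≈⟨ x∙yz≈y∙xz _ r _ ⟩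
      r * expansionTerm N j ∎
      where
      minors : det (minor j M) ≈ r * det (minor j N)
      minors = det-*-column (punchOut j≢c) r (minor-agreeOffColumn M≈N j≢c) λ i → begin
        minor j M i (punchOut j≢c) ≡⟨ minor-column M j≢c i ⟩
        M (suc i) c ≈⟨ M≈rN (suc i) ⟩
        r * N (suc i) c ≡⟨ ≡.cong (r *_) (minor-column N j≢c i) ⟨
        r * minor j N i (punchOut j≢c) ∎

  setColumn : ∀ {n} → Matrix n → Fin n → (Fin n → Carrier) → Matrix n
  setColumn M c v i = updateAt (M i) c (const (v i))

  module _ {n} (M : Matrix n) (c : Fin n) where

    setColumn-≡ : ∀ v i → setColumn M c v i c ≈ v i
    setColumn-≡ v i = reflexive (updateAt-updates c (M i))

    setColumn-≢ : ∀ v i {j} → j ≢ c → setColumn M c v i j ≈ M i j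
    setColumn-≢ v i {j} j≢c = reflexive (updateAt-minimal j c (M i) j≢c)

    agreeOff-setColumn : ∀ v → AgreeOffColumn c M (setColumn M c v)
    agreeOff-setColumn v i j j≢c = sym (setColumn-≢ v i j≢c)

    setColumns-agreeOff : ∀ u v → AgreeOffColumn c (setColumn M c u) (setColumn M c v)
    setColumns-agreeOff u v i j j≢c = trans (setColumn-≢ u i j≢c) (sym (setColumn-≢ v i j≢c))

    setColumn-self : ∀ v → (∀ i → M i c ≈ v i) → M ≋ₘ setColumn M c v
    setColumn-self v M≈v i j with j ≟ c
    ... | yes ≡.refl = trans (M≈v i) (sym (setColumn-≡ v i))
    ... | no j≢c = sym (setColumn-≢ v i j≢c)

    det-setColumn-cong : ∀ {u v} → (∀ i → u i ≈ v i) → det (setColumn M c u) ≈ det (setColumn M c v)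
    det-setColumn-cong {u} {v} u≈v = det-cong entries
      where
      entries : setColumn M c u ≋ₘ setColumn M c v
      entries i j with j ≟ c
      ... | yes ≡.refl = trans (setColumn-≡ u i) (trans (u≈v i) (sym (setColumn-≡ v i)))
      ... | no j≢c = setColumns-agreeOff u v i j j≢c

    det-setColumn-+ : ∀ u v → det (setColumn M c (λ i → u i + v i)) ≈ det (setColumn M c u) + det (setColumn M c v)
    det-setColumn-+ u v = det-+-column c (setColumns-agreeOff u+v u) (setColumns-agreeOff u+v v) λ i →
      trans (setColumn-≡ u+v i) (sym (+-cong (setColumn-≡ u i) (setColumn-≡ v i)))
      where u+v = λ i → u i + v i

    det-setColumn-* : ∀ r v → det (setColumn M c (λ i → r * v i)) ≈ r * det (setColumn M c v)
    det-setColumn-* r v = det-*-column c r (setColumns-agreeOff rv v) λ i →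
      trans (setColumn-≡ rv i) (*-congˡ (sym (setColumn-≡ v i)))
      where rv = λ i → r * v i

    det-setColumn-∑ : ∀ {m} (a : Fin m → Carrier) (v : Fin m → Fin n → Carrier) →
      det (setColumn M c (λ i → ∑[ t < m ] (a t * v t i))) ≈ ∑[ t < m ] (a t * det (setColumn M c (v t)))
    det-setColumn-∑ {zero} a v = begin
      det (setColumn M c (λ _ → 0#)) ≈⟨ det-setColumn-cong (λ _ → sym (zeroˡ 0#)) ⟩
      det (setColumn M c (λ _ → 0# * 0#)) ≈⟨ det-setColumn-* 0# (λ _ → 0#) ⟩
      0# * det (setColumn M c (λ _ → 0#)) ≈⟨ zeroˡ _ ⟩
      0# ∎
    det-setColumn-∑ {suc m} a v = begin
      det (setColumn M c (λ i → a zero * v zero i + ∑[ t < m ] (a (suc t) * v (suc t) i)))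
        ≈⟨ det-setColumn-+ _ _ ⟩
      det (setColumn M c (λ i → a zero * v zero i)) + det (setColumn M c (λ i → ∑[ t < m ] (a (suc t) * v (suc t) i)))
        ≈⟨ +-cong (det-setColumn-* (a zero) (v zero)) (det-setColumn-∑ (a ∘ suc) (v ∘ suc)) ⟩
      a zero * det (setColumn M c (v zero)) + ∑[ t < m ] (a (suc t) * det (setColumn M c (v (suc t)))) ∎

  EqualColumns : ∀ {n} → Matrix n → Fin n → Fin n → Set ℓ
  EqualColumns M a b = ∀ i → M i a ≈ M i b

  minor-adjacent : ∀ {n} {a : Fin n} {M : Matrix (suc n)} → EqualColumns M (inject₁ a) (suc a) →
                   minor (inject₁ a) M ≋ₘ minor (suc a) M
  minor-adjacent {a = a} {M} eq i k with punchIn-adjacent a k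
  ... | inj₁ e = reflexive (≡.cong (M (suc i)) e)
  ... | inj₂ (e , e′) = begin
    M (suc i) (punchIn (inject₁ a) k) ≡⟨ ≡.cong (M (suc i)) e ⟩
    M (suc i) (suc a) ≈⟨ eq (suc i) ⟨
    M (suc i) (inject₁ a) ≡⟨ ≡.cong (M (suc i)) e′ ⟨
    M (suc i) (punchIn (suc a) k) ∎

  expansionTerm-adjacent : ∀ {n} (M : Matrix (suc n)) (a : Fin n) → EqualColumns M (inject₁ a) (suc a) →
                           expansionTerm M (suc a) ≈ - expansionTerm M (inject₁ a)
  expansionTerm-adjacent M a eq = begin
    sgn (toℕ (suc a)) * (M zero (suc a) * det (minor (suc a) M))
      ≡⟨ ≡.cong (λ k → sgn (suc k) * (M zero (suc a) * det (minor (suc a) M))) (toℕ-inject₁ a) ⟨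
    sgn (suc (toℕ (inject₁ a))) * (M zero (suc a) * det (minor (suc a) M))
      ≈⟨ *-cong (sgn-suc (toℕ (inject₁ a)))
                (*-cong (sym (eq zero)) (det-cong λ i k → sym (minor-adjacent {M = M} eq i k))) ⟩
    - sgn (toℕ (inject₁ a)) * (M zero (inject₁ a) * det (minor (inject₁ a) M))
      ≈⟨ -‿distribˡ-* _ _ ⟨
    - expansionTerm M (inject₁ a) ∎

  -- The terms of the two equal columns cancel; every other term has a minor
  -- that still contains two equal adjacent columns.
  det-adjacentEqualColumns : ∀ {n} (M : Matrix (suc n)) (a : Fin n) →
                             EqualColumns M (inject₁ a) (suc a) → det M ≈ 0#
  det-adjacentEqualColumns {suc n} M a eq = begin
    det M
      ≈⟨ sum-remove {i = inject₁ a} term ⟩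
    term (inject₁ a) + sum (term ∘ punchIn (inject₁ a))
      ≈⟨ +-congˡ (sum-remove {i = a} (term ∘ punchIn (inject₁ a))) ⟩
    term (inject₁ a) + (term (punchIn (inject₁ a) a) + sum others)
      ≈⟨ +-congˡ (+-cong (reflexive (≡.cong term (punchIn-inject₁-self a))) (sum-≈0 others othersVanish)) ⟩
    term (inject₁ a) + (term (suc a) + 0#)
      ≈⟨ +-congˡ (trans (+-identityʳ _) (expansionTerm-adjacent M a eq)) ⟩
    term (inject₁ a) + - term (inject₁ a) ≈⟨ -‿inverseʳ _ ⟩
    0# ∎
    where
    term = expansionTerm M
    others : Fin n → Carrier
    others = term ∘ punchIn (inject₁ a) ∘ punchIn a
    othersVanish : ∀ s → others s ≈ 0#
    othersVanish s = trans (*-congˡ (trans (*-congˡ minorVanishes) (zeroʳ _))) (zeroʳ _)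
      where
      j = punchIn (inject₁ a) (punchIn a s)
      j≢a+1 : j ≢ suc a
      j≢a+1 e = punchInᵢ≢i a s (punchIn-injective (inject₁ a) _ _ (≡.trans e (≡.sym (punchIn-inject₁-self a))))
      minorVanishes : det (minor j M) ≈ 0#
      minorVanishes with a′ , e , e′ ← punchIn-adjacentPair j a (punchInᵢ≢i (inject₁ a) _) j≢a+1 =
        det-adjacentEqualColumns (minor j M) a′ λ i → begin
          M (suc i) (punchIn j (inject₁ a′)) ≡⟨ ≡.cong (M (suc i)) e ⟩
          M (suc i) (inject₁ a) ≈⟨ eq (suc i) ⟩
          M (suc i) (suc a) ≡⟨ ≡.cong (M (suc i)) e′ ⟨
          M (suc i) (punchIn j (suc a′)) ∎

  setAdjacentColumns : ∀ {n} → Matrix (suc n) → Fin n → (u v : Fin (suc n) → Carrier) → Matrix (suc n)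
  setAdjacentColumns M a u v = setColumn (setColumn M (inject₁ a) u) (suc a) v

  module _ {n} (M : Matrix (suc n)) (a : Fin n) where

    private
      P = setAdjacentColumns M a

    setAdjacentColumns-left : ∀ u v i → P u v i (inject₁ a) ≈ u i
    setAdjacentColumns-left u v i = trans (setColumn-≢ (setColumn M (inject₁ a) u) (suc a) v i (inject₁≢suc a))
                                          (setColumn-≡ M (inject₁ a) u i)

    setAdjacentColumns-self : M ≋ₘ P (λ i → M i (inject₁ a)) (λ i → M i (suc a))
    setAdjacentColumns-self i j = trans (setColumn-self M (inject₁ a) left (λ _ → refl) i j)
      (setColumn-self (setColumn M (inject₁ a) left) (suc a) (λ i → M i (suc a))
        (λ i → setColumn-≢ M (inject₁ a) left i (inject₁≢suc a ∘ ≡.sym)) i j)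
      where left = λ i → M i (inject₁ a)

    det-setAdjacentColumns-equal : ∀ u → det (P u u) ≈ 0#
    det-setAdjacentColumns-equal u = det-adjacentEqualColumns (P u u) a λ i →
      trans (setAdjacentColumns-left u u i) (sym (setColumn-≡ (setColumn M (inject₁ a) u) (suc a) u i))

    det-setAdjacentColumns-+ˡ : ∀ u u′ v → det (P (λ i → u i + u′ i) v) ≈ det (P u v) + det (P u′ v)
    det-setAdjacentColumns-+ˡ u u′ v = det-+-column (inject₁ a) (agree u) (agree u′) λ i →
      trans (setAdjacentColumns-left u+u′ v i)
            (sym (+-cong (setAdjacentColumns-left u v i) (setAdjacentColumns-left u′ v i)))
      where
      u+u′ = λ i → u i + u′ i
      agree : ∀ u″ → AgreeOffColumn (inject₁ a) (P u+u′ v) (P u″ v)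
      agree u″ i j j≢a with j ≟ suc a
      ... | yes ≡.refl = trans (setColumn-≡ (setColumn M (inject₁ a) u+u′) (suc a) v i)
                               (sym (setColumn-≡ (setColumn M (inject₁ a) u″) (suc a) v i))
      ... | no j≢a+1 = begin
        P u+u′ v i j ≈⟨ setColumn-≢ (setColumn M (inject₁ a) u+u′) (suc a) v i j≢a+1 ⟩
        setColumn M (inject₁ a) u+u′ i j ≈⟨ setColumns-agreeOff M (inject₁ a) u+u′ u″ i j j≢a ⟩
        setColumn M (inject₁ a) u″ i j ≈⟨ setColumn-≢ (setColumn M (inject₁ a) u″) (suc a) v i j≢a+1 ⟨
        P u″ v i j ∎

    det-setAdjacentColumns-+ʳ : ∀ u v v′ → det (P u (λ i → v i + v′ i)) ≈ det (P u v) + det (P u v′)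
    det-setAdjacentColumns-+ʳ u = det-setColumn-+ (setColumn M (inject₁ a) u) (suc a)

    -- Bilinearity and det (P u u) ≈ 0 give 0 ≈ det (P w w) ≈ det (P ca cb) + det (P cb ca) for w = ca + cb.
    det-swapAdjacentColumns : det (P (λ i → M i (suc a)) (λ i → M i (inject₁ a))) ≈ - det M
    det-swapAdjacentColumns = +-inverseʳ-unique (det M) _ (begin
      det M + det (P cb ca)
        ≈⟨ +-cong (+-identityˡ _) (+-identityʳ _) ⟨
      (0# + det M) + (det (P cb ca) + 0#)
        ≈⟨ +-cong (+-cong (sym (det-setAdjacentColumns-equal ca)) (det-cong setAdjacentColumns-self))
                  (+-congˡ (sym (det-setAdjacentColumns-equal cb))) ⟩
      (det (P ca ca) + det (P ca cb)) + (det (P cb ca) + det (P cb cb))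
        ≈⟨ +-cong (det-setAdjacentColumns-+ʳ ca ca cb) (det-setAdjacentColumns-+ʳ cb ca cb) ⟨
      det (P ca w) + det (P cb w) ≈⟨ det-setAdjacentColumns-+ˡ ca cb w ⟨
      det (P w w) ≈⟨ det-setAdjacentColumns-equal w ⟩
      0# ∎)
      where
      ca cb w : Fin (suc n) → Carrier
      ca i = M i (inject₁ a)
      cb i = M i (suc a)
      w i = ca i + cb i

  -- Swapping column b with its left neighbour moves the copy of column a one step closer.
  det-equalColumns-gap : ∀ d {n} (M : Matrix n) (a b : Fin n) → suc (toℕ a ℕ.+ d) ≡ toℕ b →
                         EqualColumns M a b → det M ≈ 0#
  det-equalColumns-gap d M a zero ()
  det-equalColumns-gap zero M a (suc b) a+1≡b+1 eq
    with toℕ-injective {i = a} {j = inject₁ b}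
           (≡.trans (≡.sym (ℕ.+-identityʳ (toℕ a)))
                    (≡.trans (ℕ.suc-injective a+1≡b+1) (≡.sym (toℕ-inject₁ b))))
  ... | ≡.refl = det-adjacentEqualColumns M b eq
  det-equalColumns-gap (suc d) {suc n} M a (suc b) gap eq = begin
    det M ≈⟨ -‿involutive _ ⟨
    - - det M ≈⟨ -‿cong (det-swapAdjacentColumns M b) ⟨
    - det M′ ≈⟨ -‿cong (det-equalColumns-gap d M′ a (inject₁ b) gap′ eq′) ⟩
    - 0# ≈⟨ -0#≈0# ⟩
    0# ∎
    where
    M′ = setAdjacentColumns M b (λ i → M i (suc b)) (λ i → M i (inject₁ b))
    gap′ : suc (toℕ a ℕ.+ d) ≡ toℕ (inject₁ b)
    gap′ = ≡.trans (≡.sym (ℕ.+-suc (toℕ a) d)) (≡.trans (ℕ.suc-injective gap) (≡.sym (toℕ-inject₁ b)))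
    a≢b : a ≢ inject₁ b
    a≢b a≡b = ℕ.m≢1+m+n (toℕ a) (≡.trans (≡.cong toℕ a≡b) (≡.sym gap′))
    a≢b+1 : a ≢ suc b
    a≢b+1 a≡b+1 = ℕ.m≢1+m+n (toℕ a) (≡.trans (≡.cong toℕ a≡b+1) (≡.sym gap))
    eq′ : EqualColumns M′ a (inject₁ b)
    eq′ i = begin
      M′ i a ≈⟨ setColumn-≢ M″ (suc b) left i a≢b+1 ⟩
      M″ i a ≈⟨ setColumn-≢ M (inject₁ b) right i a≢b ⟩
      M i a ≈⟨ eq i ⟩
      M i (suc b) ≈⟨ setColumn-≡ M (inject₁ b) right i ⟨
      M″ i (inject₁ b) ≈⟨ setColumn-≢ M″ (suc b) left i (inject₁≢suc b) ⟨
      M′ i (inject₁ b) ∎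
      where
      left right : Fin (suc n) → Carrier
      left i = M i (inject₁ b)
      right i = M i (suc b)
      M″ = setColumn M (inject₁ b) right

  det-equalColumns : ∀ {n} (M : Matrix n) {a b : Fin n} → a ≢ b → EqualColumns M a b → det M ≈ 0#
  det-equalColumns M {a} {b} a≢b eq with <-cmp a b
  ... | tri< a<b _ _ = let d , gap = ℕ.m≤n⇒∃[o]m+o≡n a<b in det-equalColumns-gap d M a b gap eq
  ... | tri≈ _ a≡b _ = contradiction a≡b a≢b
  ... | tri> _ _ b<a = let d , gap = ℕ.m≤n⇒∃[o]m+o≡n b<a in det-equalColumns-gap d M b a gap (sym ∘ eq)

  δ : ∀ {n} → Fin n → Fin n → Carrier
  δ f j = if does (f ≟ j) then 1# else 0#

  δ-diagonal : ∀ {n} (j : Fin n) → δ j j ≈ 1#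
  δ-diagonal j rewrite ≡.≡-≟-identity _≟_ {j} ≡.refl = refl

  δ-offDiagonal : ∀ {n} {f j : Fin n} → f ≢ j → δ f j ≈ 0#
  δ-offDiagonal {f = f} {j} f≢j rewrite dec-no (f ≟ j) f≢j = refl

  ∑-δ : ∀ {n} (j : Fin n) (h : Fin n → Carrier) → ∑[ f < n ] (δ f j * h f) ≈ h j
  ∑-δ {suc n} j h = begin
    ∑[ f < suc n ] (δ f j * h f) ≈⟨ sum-remove {i = j} (λ f → δ f j * h f) ⟩
    δ j j * h j + ∑[ s < n ] (δ (punchIn j s) j * h (punchIn j s))
      ≈⟨ +-cong (*-congʳ (δ-diagonal j))
                (sum-≈0 _ λ s → trans (*-congʳ (δ-offDiagonal (punchInᵢ≢i j s))) (zeroˡ _)) ⟩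
    1# * h j + 0# ≈⟨ trans (+-identityʳ _) (*-identityˡ _) ⟩
    h j ∎

  ∣-+ : ∀ {a b d} → a ∣ b → a ∣ d → a ∣ b + d
  ∣-+ {a} (q , qa≈b) (r , ra≈d) = q + r , trans (distribʳ a q r) (+-cong qa≈b ra≈d)

  ∣-∑ : ∀ {n a} (f : Fin n → Carrier) → (∀ t → a ∣ f t) → a ∣ sum f
  ∣-∑ {zero} {a} f _ = a ∣0
  ∣-∑ {suc n} f a∣f = ∣-+ (a∣f zero) (∣-∑ (f ∘ suc) (a∣f ∘ suc))

  x^m∣y⇒x^[1+m]∣xy : ∀ x {m y} → x ^ m ∣ y → x ^ suc m ∣ x * y
  x^m∣y⇒x^[1+m]∣xy x {m} (q , q*x^m≈y) = q , trans (x∙yz≈y∙xz q x (x ^ m)) (*-congˡ q*x^m≈y)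

  x^m∣x^n : ∀ x {m n} → m ℕ.≤ n → x ^ m ∣ x ^ n
  x^m∣x^n x {m} m≤n with d , m+d≡n ← ℕ.m≤n⇒∃[o]m+o≡n m≤n =
    x ^ d , trans (*-comm (x ^ d) (x ^ m)) (sym (trans (^-congʳ x (≡.sym m+d≡n)) (^-homo-* x m d)))

  RankAtMost : ∀ {m p} → ℕ → (Fin m → Fin p → Carrier) → Set (c ⊔ ℓ)
  RankAtMost {m} {p} K N = Σ[ u ∈ (Fin K → Fin m → Carrier) ] Σ[ v ∈ (Fin K → Fin p → Carrier) ]
                             (∀ i j → N i j ≈ ∑[ t < K ] (u t i * v t j))

  sum-splitAt : ∀ K {L} (h : Fin K ⊎ Fin L → Carrier) →
                ∑[ t < K ℕ.+ L ] h (splitAt K t) ≈ ∑[ τ < K ] h (inj₁ τ) + ∑[ τ < L ] h (inj₂ τ)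
  sum-splitAt zero h = sym (+-identityˡ _)
  sum-splitAt (suc K) h = trans (+-congˡ (sum-splitAt K (h ∘ Sum.map₁ suc))) (sym (+-assoc _ _ _))

  rankAtMost-cong : ∀ {m p K} {N N′ : Fin m → Fin p → Carrier} →
                    (∀ i j → N i j ≈ N′ i j) → RankAtMost K N → RankAtMost K N′
  rankAtMost-cong N≈N′ (u , v , N≈uv) = u , v , λ i j → trans (sym (N≈N′ i j)) (N≈uv i j)

  rankAtMost-outer : ∀ {m p} (a : Fin m → Carrier) (b : Fin p → Carrier) → RankAtMost 1 (λ i j → a i * b j)
  rankAtMost-outer a b = (λ _ → a) , (λ _ → b) , λ i j → sym (+-identityʳ _)

  rankAtMost-+ : ∀ {m p K L} {N N′ : Fin m → Fin p → Carrier} → RankAtMost K N → RankAtMost L N′ →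
                 RankAtMost (K ℕ.+ L) (λ i j → N i j + N′ i j)
  rankAtMost-+ {K = K} (u , v , N≈uv) (u′ , v′ , N′≈uv′) =
    [ u , u′ ]′ ∘ splitAt K , [ v , v′ ]′ ∘ splitAt K , λ i j →
      trans (+-cong (N≈uv i j) (N′≈uv′ i j))
            (sym (sum-splitAt K λ s → [ u , u′ ]′ s i * [ v , v′ ]′ s j))

  rankAtMost-* : ∀ {m p K} {N : Fin m → Fin p → Carrier} r → RankAtMost K N → RankAtMost K (λ i j → r * N i j)
  rankAtMost-* r (u , v , N≈uv) = (λ t i → r * u t i) , v , λ i j → begin
    r * _ ≈⟨ *-congˡ (N≈uv i j) ⟩
    r * sum (λ t → u t i * v t j) ≈⟨ *-distribˡ-sum r (λ t → u t i * v t j) ⟩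
    sum (λ t → r * (u t i * v t j)) ≈⟨ sum-cong-≋ {x = λ t → r * (u t i * v t j)} (λ t → sym (*-assoc _ _ _)) ⟩
    sum (λ t → (r * u t i) * v t j) ∎

  rankAtMost-transpose : ∀ {m p K} {N : Fin m → Fin p → Carrier} → RankAtMost K N → RankAtMost K (λ j i → N i j)
  rankAtMost-transpose (u , v , N≈uv) = v , u , λ j i →
    trans (N≈uv i j) (sum-cong-≋ {x = λ t → u t i * v t j} λ t → *-comm _ _)

  enumerate : ∀ {m} (S : Subset m) → Fin ∣ S ∣ → Fin m
  enumerate (true ∷ S) zero = zero
  enumerate (true ∷ S) (suc τ) = suc (enumerate S τ)
  enumerate (false ∷ S) τ = suc (enumerate S τ)

  ∑-enumerate-δ : ∀ {m} (S : Subset m) (h : Fin m → Carrier) → (∀ a → a ∉ S → h a ≈ 0#) →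
                  ∀ a → ∑[ τ < ∣ S ∣ ] (δ (enumerate S τ) a * h (enumerate S τ)) ≈ h a
  ∑-enumerate-δ (true ∷ S) h h≈0 zero = begin
    1# * h zero + ∑[ τ < ∣ S ∣ ] (0# * h (suc (enumerate S τ)))
      ≈⟨ +-cong (*-identityˡ _) (sum-≈0 (λ τ → 0# * h (suc (enumerate S τ))) λ τ → zeroˡ _) ⟩
    h zero + 0# ≈⟨ +-identityʳ _ ⟩
    h zero ∎
  ∑-enumerate-δ (true ∷ S) h h≈0 (suc a) =
    trans (+-cong (zeroˡ _) (∑-enumerate-δ S (h ∘ suc) (λ a a∉S → h≈0 (suc a) λ { (there a∈S) → a∉S a∈S }) a))
          (+-identityˡ _)
  ∑-enumerate-δ (false ∷ S) h h≈0 zero =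
    trans (sum-≈0 (λ τ → 0# * h (suc (enumerate S τ))) λ τ → zeroˡ _) (sym (h≈0 zero λ ()))
  ∑-enumerate-δ (false ∷ S) h h≈0 (suc a) =
    ∑-enumerate-δ S (h ∘ suc) (λ a a∉S → h≈0 (suc a) λ { (there a∈S) → a∉S a∈S }) a

  rankAtMost-rows : ∀ {m p} {N : Fin m → Fin p → Carrier} (S : Subset m) →
                    (∀ a b → a ∉ S → N a b ≈ 0#) → RankAtMost ∣ S ∣ N
  rankAtMost-rows {N = N} S N≈0 = (λ τ a → δ (enumerate S τ) a) , (λ τ → N (enumerate S τ)) , λ a b →
    sym (∑-enumerate-δ S (λ a → N a b) (λ a a∉S → N≈0 a b a∉S) a)

  rankAtMost-columns : ∀ {m p} {N : Fin m → Fin p → Carrier} (S : Subset p) →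
                       (∀ a b → b ∉ S → N a b ≈ 0#) → RankAtMost ∣ S ∣ N
  rankAtMost-columns S N≈0 = rankAtMost-transpose (rankAtMost-rows S λ b a → N≈0 a b)

  bipartite : ∀ {p q} → (Fin p → Fin q → Carrier) → Fin p ⊎ Fin q → Fin p ⊎ Fin q → Carrier
  bipartite N (inj₁ a) (inj₂ b) = N a b
  bipartite N (inj₂ b) (inj₁ a) = N a b
  bipartite N (inj₁ _) (inj₁ _) = 0#
  bipartite N (inj₂ _) (inj₂ _) = 0#

  rankAtMost-bipartite : ∀ {p q K} {N : Fin p → Fin q → Carrier} → RankAtMost K N →
                         RankAtMost (K ℕ.+ K) (λ i j → bipartite N (splitAt p i) (splitAt p j))
  rankAtMost-bipartite {p} {q} {K} {N} (u , v , N≈uv) =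
    rankAtMost-cong (λ i j → entry (splitAt p i) (splitAt p j))
      (rankAtMost-+ (û , v̂ , λ _ _ → refl) (v̂ , û , λ _ _ → refl))
    where
    û v̂ : Fin K → Fin (p ℕ.+ q) → Carrier
    û t i = [ u t , const 0# ]′ (splitAt p i)
    v̂ t j = [ const 0# , v t ]′ (splitAt p j)
    ∑0 : ∀ (f g : Fin K → Carrier) → ∑[ t < K ] (f t * 0#) + ∑[ t < K ] (0# * g t) ≈ 0#
    ∑0 f g = trans (+-cong (sum-≈0 _ λ t → zeroʳ (f t)) (sum-≈0 _ λ t → zeroˡ (g t))) (+-identityʳ 0#)
    entry : ∀ s₁ s₂ →
      ∑[ t < K ] ([ u t , const 0# ]′ s₁ * [ const 0# , v t ]′ s₂)
        + ∑[ t < K ] ([ const 0# , v t ]′ s₁ * [ u t , const 0# ]′ s₂) ≈ bipartite N s₁ s₂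
    entry (inj₁ a) (inj₁ a′) = ∑0 (λ t → u t a) (λ t → u t a′)
    entry (inj₂ b) (inj₂ b′) = trans (+-comm _ _) (∑0 (λ t → v t b) (λ t → v t b′))
    entry (inj₁ a) (inj₂ b) = begin
      ∑[ t < K ] (u t a * v t b) + ∑[ t < K ] (0# * 0#)
        ≈⟨ +-cong (sym (N≈uv a b)) (sum-≈0 {K} _ λ _ → zeroˡ 0#) ⟩
      N a b + 0# ≈⟨ +-identityʳ _ ⟩
      N a b ∎
    entry (inj₂ b) (inj₁ a) = begin
      ∑[ t < K ] (0# * 0#) + ∑[ t < K ] (v t b * u t a)
        ≈⟨ +-cong (sum-≈0 {K} _ λ _ → zeroˡ 0#) (sum-cong-≋ {x = λ t → v t b * u t a} λ t → *-comm _ _) ⟩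
      0# + ∑[ t < K ] (u t a * v t b) ≈⟨ +-identityˡ _ ⟩
      ∑[ t < K ] (u t a * v t b) ≈⟨ N≈uv a b ⟨
      N a b ∎

  -- Invariant of the column-by-column expansion of det (x D + Σₜ uₜ wₜᵀ): every
  -- column j ≥ F is x·Dⱼ plus a combination of the remaining directions uₜ plus a
  -- combination (with coefficients g) of the already expanded columns f < F.
  -- Expanding column F either gains a factor x, or uses up one direction uₜ
  -- (whose later occurrences become multiples of column F), or copies an
  -- earlier column (determinant 0).
  module LowRankPerturbation (x : Carrier) {n : ℕ} where

    SupportedBelow : ℕ → Matrix n → Set ℓ
    SupportedBelow F g = ∀ f j → F ℕ.≤ toℕ f → g f j ≈ 0#

    record LowRankColumnsFrom {ρ} (F : ℕ) (M D : Matrix n) (u w : Fin ρ → Fin n → Carrier) (g : Matrix n) : Set ℓ where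
      constructor lowRankColumns
      field column : ∀ i j → F ℕ.≤ toℕ j →
                     M i j ≈ (x * D i j + ∑[ t < ρ ] (w t j * u t i)) + ∑[ f < n ] (g f j * M i f)
    open LowRankColumnsFrom

    det-expandColumn : ∀ {ρ} {M D : Matrix n} {u w : Fin ρ → Fin n → Carrier} {g : Matrix n} (c : Fin n) →
      (∀ i → M i c ≈ (x * D i c + ∑[ t < ρ ] (w t c * u t i)) + ∑[ f < n ] (g f c * M i f)) →
      det M ≈ (x * det (setColumn M c (λ i → D i c)) + ∑[ t < ρ ] (w t c * det (setColumn M c (u t))))
              + ∑[ f < n ] (g f c * det (setColumn M c (λ i → M i f)))
    det-expandColumn {ρ} {M} {D} {u} {w} {g} c column = begin
      det M ≈⟨ det-cong (setColumn-self M c _ column) ⟩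
      det (setColumn M c λ i → (x * D i c + ∑[ t < ρ ] (w t c * u t i)) + ∑[ f < n ] (g f c * M i f))
        ≈⟨ det-setColumn-+ M c _ _ ⟩
      det (setColumn M c λ i → x * D i c + ∑[ t < ρ ] (w t c * u t i))
        + det (setColumn M c λ i → ∑[ f < n ] (g f c * M i f))
        ≈⟨ +-cong (det-setColumn-+ M c _ _) (det-setColumn-∑ M c (λ f → g f c) (λ f i → M i f)) ⟩
      (det (setColumn M c λ i → x * D i c) + det (setColumn M c λ i → ∑[ t < ρ ] (w t c * u t i)))
        + ∑[ f < n ] (g f c * det (setColumn M c (λ i → M i f)))
        ≈⟨ +-congʳ (+-cong (det-setColumn-* M c x _) (det-setColumn-∑ M c (λ t → w t c) u)) ⟩
      (x * det (setColumn M c (λ i → D i c)) + ∑[ t < ρ ] (w t c * det (setColumn M c (u t))))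
        + ∑[ f < n ] (g f c * det (setColumn M c (λ i → M i f))) ∎

    module _ {F : ℕ} {j₀ : Fin n} (j₀≡F : toℕ j₀ ≡ F) {g : Matrix n} (g≈0 : SupportedBelow F g) where

      later≢j₀ : ∀ {j} → F ℕ.< toℕ j → j ≢ j₀
      later≢j₀ F<j ≡.refl = ℕ.<-irrefl (≡.sym j₀≡F) F<j

      ∑-earlierColumns-cong : ∀ {M N : Matrix n} → AgreeOffColumn j₀ M N →
        ∀ i j → ∑[ f < n ] (g f j * M i f) ≈ ∑[ f < n ] (g f j * N i f)
      ∑-earlierColumns-cong {M} {N} M≈N i j = sum-cong-≋ {x = λ f → g f j * M i f} term
        where
        term : ∀ f → g f j * M i f ≈ g f j * N i f
        term f with f ≟ j₀
        ... | yes ≡.refl = trans (*-congʳ g₀≈0) (trans (zeroˡ _) (sym (trans (*-congʳ g₀≈0) (zeroˡ _))))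
          where g₀≈0 = g≈0 j₀ j (ℕ.≤-reflexive (≡.sym j₀≡F))
        ... | no f≢j₀ = *-congˡ (M≈N i f f≢j₀)

      setColumn-scaled : ∀ {ρ} {M D : Matrix n} {u w : Fin ρ → Fin n → Carrier} →
        LowRankColumnsFrom F M D u w g → LowRankColumnsFrom (suc F) (setColumn M j₀ (λ i → D i j₀)) D u w g
      setColumn-scaled {M = M} {D} columns = lowRankColumns λ i j F<j → begin
        setColumn M j₀ (λ i → D i j₀) i j ≈⟨ setColumn-≢ M j₀ (λ i → D i j₀) i (later≢j₀ F<j) ⟩
        M i j ≈⟨ column columns i j (ℕ.<⇒≤ F<j) ⟩
        _ + ∑[ f < n ] (g f j * M i f)
          ≈⟨ +-congˡ (∑-earlierColumns-cong (agreeOff-setColumn M j₀ (λ i → D i j₀)) i j) ⟩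
        _ + ∑[ f < n ] (g f j * setColumn M j₀ (λ i → D i j₀) i f) ∎

      setColumn-lowRank : ∀ {ρ} {M D : Matrix n} {u w : Fin (suc ρ) → Fin n → Carrier} (t : Fin (suc ρ)) →
        LowRankColumnsFrom F M D u w g →
        LowRankColumnsFrom (suc F) (setColumn M j₀ (u t)) D (u ∘ punchIn t) (w ∘ punchIn t)
                           (λ f j → g f j + δ f j₀ * w t j)
      setColumn-lowRank {ρ} {M} {D} {u} {w} t columns = lowRankColumns columnEq
        where
        M′ = setColumn M j₀ (u t)
        columnEq : ∀ i j → F ℕ.< toℕ j →
          M′ i j ≈ (x * D i j + ∑[ s < ρ ] (w (punchIn t s) j * u (punchIn t s) i))
                   + ∑[ f < n ] ((g f j + δ f j₀ * w t j) * M′ i f)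
        columnEq i j F<j = begin
          M′ i j ≈⟨ setColumn-≢ M j₀ (u t) i (later≢j₀ F<j) ⟩
          M i j ≈⟨ column columns i j (ℕ.<⇒≤ F<j) ⟩
          (x * D i j + ∑[ s < suc ρ ] (w s j * u s i)) + ∑[ f < n ] (g f j * M i f)
            ≈⟨ +-cong (+-congˡ (sum-remove {i = t} (λ s → w s j * u s i)))
                      (∑-earlierColumns-cong (agreeOff-setColumn M j₀ (u t)) i j) ⟩
          (x * D i j + (w t j * u t i + rest)) + ∑[ f < n ] (g f j * M′ i f)
            ≈⟨ +-congʳ (+-Comm.x∙yz≈y∙xz _ _ _) ⟩
          (w t j * u t i + (x * D i j + rest)) + ∑[ f < n ] (g f j * M′ i f)
            ≈⟨ +-Comm.xy∙z≈y∙zx _ _ _ ⟩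
          (x * D i j + rest) + (∑[ f < n ] (g f j * M′ i f) + w t j * u t i)
            ≈⟨ +-congˡ (+-congˡ absorbed) ⟨
          (x * D i j + rest) + (∑[ f < n ] (g f j * M′ i f) + ∑[ f < n ] (δ f j₀ * (w t j * M′ i f)))
            ≈⟨ +-congˡ (∑-distrib-+ (λ f → g f j * M′ i f) (λ f → δ f j₀ * (w t j * M′ i f))) ⟨
          (x * D i j + rest) + ∑[ f < n ] (g f j * M′ i f + δ f j₀ * (w t j * M′ i f))
            ≈⟨ +-congˡ (sum-cong-≋ {x = λ f → g f j * M′ i f + δ f j₀ * (w t j * M′ i f)}
                  λ f → trans (+-congˡ (sym (*-assoc _ _ _))) (sym (distribʳ _ _ _))) ⟩
          (x * D i j + rest) + ∑[ f < n ] ((g f j + δ f j₀ * w t j) * M′ i f) ∎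
          where
          rest = ∑[ s < ρ ] (w (punchIn t s) j * u (punchIn t s) i)
          absorbed : ∑[ f < n ] (δ f j₀ * (w t j * M′ i f)) ≈ w t j * u t i
          absorbed = trans (∑-δ j₀ (λ f → w t j * M′ i f)) (*-congˡ (setColumn-≡ M j₀ (u t) i))

      supportedBelow-absorb : ∀ (v : Fin n → Carrier) → SupportedBelow (suc F) (λ f j → g f j + δ f j₀ * v j)
      supportedBelow-absorb v f j F<f = begin
        g f j + δ f j₀ * v j ≈⟨ +-cong (g≈0 f j (ℕ.<⇒≤ F<f)) (*-congʳ (δ-offDiagonal (later≢j₀ F<f))) ⟩
        0# + 0# * v j ≈⟨ trans (+-identityˡ _) (zeroˡ _) ⟩
        0# ∎

      earlierColumnTerm≈0 : ∀ (M : Matrix n) f → g f j₀ * det (setColumn M j₀ (λ i → M i f)) ≈ 0#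
      earlierColumnTerm≈0 M f with f ≟ j₀
      ... | yes ≡.refl = trans (*-congʳ (g≈0 j₀ j₀ (ℕ.≤-reflexive (≡.sym j₀≡F)))) (zeroˡ _)
      ... | no f≢j₀ = trans (*-congˡ (det-equalColumns (setColumn M j₀ col) f≢j₀ λ i →
                        trans (setColumn-≢ M j₀ col i f≢j₀) (sym (setColumn-≡ M j₀ col i)))) (zeroʳ _)
        where col = λ i → M i f

    x^[k∸ρ]∣det : ∀ k {F} → F ℕ.+ k ≡ n →
      ∀ {ρ} {M D : Matrix n} {u w : Fin ρ → Fin n → Carrier} {g : Matrix n} →
      SupportedBelow F g → LowRankColumnsFrom F M D u w g → x ^ (k ∸ ρ) ∣ det M
    x^[k∸ρ]∣det zero _ {ρ} {M} _ _ = ≡.subst (λ m → x ^ m ∣ det M) (≡.sym (ℕ.0∸n≡0 ρ)) (ε∣ʳ det M)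
    x^[k∸ρ]∣det (suc k) {F} F+[1+k]≡n {ρ} {M} {D} {u} {w} {g} g≈0 columns =
      ∣ʳ-respʳ-≈ (sym (det-expandColumn {ρ} {M} {D} {u} {w} {g} j₀ λ i →
                         column columns i j₀ (ℕ.≤-reflexive (≡.sym j₀≡F))))
        (∣-+ (∣-+ scaledTerm (lowRankTerms columns)) earlierTerms)
      where
      F<n : F ℕ.< n
      F<n = ≡.subst (F ℕ.<_) F+[1+k]≡n (ℕ.m<m+n F (ℕ.s≤s ℕ.z≤n))
      j₀ = Fin.fromℕ< F<n
      j₀≡F = toℕ-fromℕ< F<n
      [1+F]+k≡n : suc F ℕ.+ k ≡ n
      [1+F]+k≡n = ≡.trans (≡.sym (ℕ.+-suc F k)) F+[1+k]≡n
      scaledTerm : x ^ (suc k ∸ ρ) ∣ x * det (setColumn M j₀ (λ i → D i j₀))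
      scaledTerm = ∣ʳ-trans (x^m∣x^n x ([1+m]∸n≤1+[m∸n] k ρ)) (x^m∣y⇒x^[1+m]∣xy x {k ∸ ρ}
        (x^[k∸ρ]∣det k [1+F]+k≡n (λ f j F<f → g≈0 f j (ℕ.<⇒≤ F<f)) (setColumn-scaled j₀≡F g≈0 columns)))
      lowRankTerms : ∀ {ρ} {u w : Fin ρ → Fin n → Carrier} → LowRankColumnsFrom F M D u w g →
        x ^ (suc k ∸ ρ) ∣ ∑[ t < ρ ] (w t j₀ * det (setColumn M j₀ (u t)))
      lowRankTerms {zero} _ = _ ∣0
      lowRankTerms {suc ρ} {u} {w} columns = ∣-∑ _ λ t → x∣ʳy⇒x∣ʳzy (w t j₀)
        (x^[k∸ρ]∣det k [1+F]+k≡n (supportedBelow-absorb j₀≡F g≈0 (w t)) (setColumn-lowRank j₀≡F g≈0 t columns))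
      earlierTerms : x ^ (suc k ∸ ρ) ∣ ∑[ f < n ] (g f j₀ * det (setColumn M j₀ (λ i → M i f)))
      earlierTerms = ∣ʳ-respʳ-≈ (sym (sum-≈0 _ (earlierColumnTerm≈0 j₀≡F g≈0 M))) (_ ∣0)

    x^[n∸ρ]∣det : ∀ {ρ} {M D N : Matrix n} → RankAtMost ρ N → (∀ i j → M i j ≈ x * D i j + N i j) →
                  x ^ (n ∸ ρ) ∣ det M
    x^[n∸ρ]∣det {ρ} {M} {D} {N} (u , v , N≈uv) M≈xD+N =
      x^[k∸ρ]∣det n ≡.refl {ρ} {M} {D} {u} {v} {λ _ _ → 0#} (λ _ _ _ → refl) (lowRankColumns λ i j _ → begin
        M i j ≈⟨ M≈xD+N i j ⟩
        x * D i j + N i j ≈⟨ +-congˡ (N≈uv i j) ⟩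
        x * D i j + ∑[ t < ρ ] (u t i * v t j)
          ≈⟨ +-congˡ (sum-cong-≋ {x = λ t → u t i * v t j} λ t → *-comm _ _) ⟩
        x * D i j + ∑[ t < ρ ] (v t j * u t i) ≈⟨ +-identityʳ _ ⟨
        (x * D i j + ∑[ t < ρ ] (v t j * u t i)) + 0# ≈⟨ +-congˡ (sum-≈0 _ λ f → zeroˡ (M i f)) ⟨
        (x * D i j + ∑[ t < ρ ] (v t j * u t i)) + ∑[ f < n ] (0# * M i f) ∎)

open import Defs
open import Data.Integer as ℤ using (ℤ; +_; -_)
import Data.Integer.Properties as ℤ
import Data.Integer.Tactic.RingSolver as ℤ-Solver
open import Data.List using ([]; _∷_; length; map; foldr; tabulate)
import Data.List.Properties as List
open import Data.Nat using (_+_; _*_; _⊓_; _≤_; _<_; z≤n; s≤s)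
import Data.Nat.Tactic.RingSolver as ℕ-Solver
open ≡ using (refl; cong; cong₂)

module Polynomial where

  open ≡.≡-Reasoning

  coeff : Poly → ℕ → ℤ
  coeff [] i = + 0
  coeff (a ∷ p) zero = a
  coeff (a ∷ p) (suc i) = coeff p i

  infix 4 _≈ₚ_
  record _≈ₚ_ (p q : Poly) : Set where
    constructor coeffwise
    field coeff-≡ : ∀ i → coeff p i ≡ coeff q i
  open _≈ₚ_ public

  ≈ₚ-refl : ∀ {p} → p ≈ₚ p
  ≈ₚ-refl = coeffwise λ _ → refl

  ≈ₚ-sym : ∀ {p q} → p ≈ₚ q → q ≈ₚ p
  ≈ₚ-sym p≈q = coeffwise λ i → ≡.sym (coeff-≡ p≈q i)

  ≈ₚ-trans : ∀ {p q r} → p ≈ₚ q → q ≈ₚ r → p ≈ₚ r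
  ≈ₚ-trans p≈q q≈r = coeffwise λ i → ≡.trans (coeff-≡ p≈q i) (coeff-≡ q≈r i)

  shift : Poly → Poly
  shift p = + 0 ∷ p

  shift-cong : ∀ {p q} → p ≈ₚ q → shift p ≈ₚ shift q
  shift-cong p≈q = coeffwise λ { zero → refl ; (suc i) → coeff-≡ p≈q i }

  shift-[] : shift [] ≈ₚ []
  shift-[] = coeffwise λ { zero → refl ; (suc i) → refl }

  coeff-+ₚ : ∀ p q i → coeff (p +ₚ q) i ≡ coeff p i ℤ.+ coeff q i
  coeff-+ₚ [] q i = ≡.sym (ℤ.+-identityˡ _)
  coeff-+ₚ (a ∷ p) [] i = ≡.sym (ℤ.+-identityʳ _)
  coeff-+ₚ (a ∷ p) (b ∷ q) zero = refl
  coeff-+ₚ (a ∷ p) (b ∷ q) (suc i) = coeff-+ₚ p q i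

  coeff-scaleₚ : ∀ c p i → coeff (scaleₚ c p) i ≡ c ℤ.* coeff p i
  coeff-scaleₚ c [] i = ≡.sym (ℤ.*-zeroʳ c)
  coeff-scaleₚ c (a ∷ p) zero = refl
  coeff-scaleₚ c (a ∷ p) (suc i) = coeff-scaleₚ c p i

  coeff-∷*ₚ : ∀ a p q i → coeff ((a ∷ p) *ₚ q) i ≡ a ℤ.* coeff q i ℤ.+ coeff (shift (p *ₚ q)) i
  coeff-∷*ₚ a p q i = ≡.trans (coeff-+ₚ (scaleₚ a q) (shift (p *ₚ q)) i) (cong (ℤ._+ _) (coeff-scaleₚ a q i))

  +ₚ-cong : ∀ {p p′ q q′} → p ≈ₚ p′ → q ≈ₚ q′ → p +ₚ q ≈ₚ p′ +ₚ q′
  +ₚ-cong {p} {p′} {q} {q′} p≈p′ q≈q′ = coeffwise λ i → begin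
    coeff (p +ₚ q) i ≡⟨ coeff-+ₚ p q i ⟩
    coeff p i ℤ.+ coeff q i ≡⟨ cong₂ ℤ._+_ (coeff-≡ p≈p′ i) (coeff-≡ q≈q′ i) ⟩
    coeff p′ i ℤ.+ coeff q′ i ≡⟨ coeff-+ₚ p′ q′ i ⟨
    coeff (p′ +ₚ q′) i ∎

  scaleₚ-cong : ∀ c {p q} → p ≈ₚ q → scaleₚ c p ≈ₚ scaleₚ c q
  scaleₚ-cong c {p} {q} p≈q = coeffwise λ i → begin
    coeff (scaleₚ c p) i ≡⟨ coeff-scaleₚ c p i ⟩
    c ℤ.* coeff p i ≡⟨ cong (c ℤ.*_) (coeff-≡ p≈q i) ⟩
    c ℤ.* coeff q i ≡⟨ coeff-scaleₚ c q i ⟨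
    coeff (scaleₚ c q) i ∎

  *ₚ-congˡ : ∀ p {q q′} → q ≈ₚ q′ → p *ₚ q ≈ₚ p *ₚ q′
  *ₚ-congˡ [] q≈q′ = ≈ₚ-refl
  *ₚ-congˡ (a ∷ p) q≈q′ = +ₚ-cong (scaleₚ-cong a q≈q′) (shift-cong (*ₚ-congˡ p q≈q′))

  +ₚ-identityʳ : ∀ p → p +ₚ [] ≈ₚ p
  +ₚ-identityʳ [] = ≈ₚ-refl
  +ₚ-identityʳ (a ∷ p) = ≈ₚ-refl

  +ₚ-assoc : ∀ p q r → (p +ₚ q) +ₚ r ≈ₚ p +ₚ (q +ₚ r)
  +ₚ-assoc p q r = coeffwise λ i → begin
    coeff ((p +ₚ q) +ₚ r) i ≡⟨ coeff-+ₚ (p +ₚ q) r i ⟩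
    coeff (p +ₚ q) i ℤ.+ coeff r i ≡⟨ cong (ℤ._+ coeff r i) (coeff-+ₚ p q i) ⟩
    (coeff p i ℤ.+ coeff q i) ℤ.+ coeff r i ≡⟨ ℤ.+-assoc (coeff p i) (coeff q i) (coeff r i) ⟩
    coeff p i ℤ.+ (coeff q i ℤ.+ coeff r i) ≡⟨ cong (λ r → coeff p i ℤ.+ r) (coeff-+ₚ q r i) ⟨
    coeff p i ℤ.+ coeff (q +ₚ r) i ≡⟨ coeff-+ₚ p (q +ₚ r) i ⟨
    coeff (p +ₚ (q +ₚ r)) i ∎

  +ₚ-comm : ∀ p q → p +ₚ q ≈ₚ q +ₚ p
  +ₚ-comm p q = coeffwise λ i → begin
    coeff (p +ₚ q) i ≡⟨ coeff-+ₚ p q i ⟩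
    coeff p i ℤ.+ coeff q i ≡⟨ ℤ.+-comm (coeff p i) (coeff q i) ⟩
    coeff q i ℤ.+ coeff p i ≡⟨ coeff-+ₚ q p i ⟨
    coeff (q +ₚ p) i ∎

  negₚ : Poly → Poly
  negₚ = scaleₚ (- + 1)

  negₚ-inverseˡ : ∀ p → negₚ p +ₚ p ≈ₚ []
  negₚ-inverseˡ p = coeffwise λ i → begin
    coeff (negₚ p +ₚ p) i ≡⟨ coeff-+ₚ (negₚ p) p i ⟩
    coeff (negₚ p) i ℤ.+ coeff p i ≡⟨ cong (ℤ._+ coeff p i) (coeff-scaleₚ (- + 1) p i) ⟩
    - + 1 ℤ.* coeff p i ℤ.+ coeff p i ≡⟨ cong (ℤ._+ coeff p i) (ℤ.-1*i≡-i (coeff p i)) ⟩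
    - coeff p i ℤ.+ coeff p i ≡⟨ ℤ.+-inverseˡ (coeff p i) ⟩
    + 0 ∎

  negₚ-inverseʳ : ∀ p → p +ₚ negₚ p ≈ₚ []
  negₚ-inverseʳ p = ≈ₚ-trans (+ₚ-comm p (negₚ p)) (negₚ-inverseˡ p)

  *ₚ-zeroʳ : ∀ p → p *ₚ [] ≈ₚ []
  *ₚ-zeroʳ [] = ≈ₚ-refl
  *ₚ-zeroʳ (a ∷ p) = ≈ₚ-trans (shift-cong (*ₚ-zeroʳ p)) shift-[]

  *ₚ-∷ʳ : ∀ p b q → p *ₚ (b ∷ q) ≈ₚ scaleₚ b p +ₚ shift (p *ₚ q)
  *ₚ-∷ʳ [] b q = ≈ₚ-sym shift-[]
  *ₚ-∷ʳ (a ∷ p) b q = coeffwise coeffs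
    where
    *-comm′ : ∀ a b → a ℤ.* b ℤ.+ + 0 ≡ b ℤ.* a ℤ.+ + 0
    *-comm′ = ℤ-Solver.solve-∀
    +-swapˡ : ∀ x y z → x ℤ.+ (y ℤ.+ z) ≡ y ℤ.+ (x ℤ.+ z)
    +-swapˡ = ℤ-Solver.solve-∀
    coeffs : ∀ i → coeff ((a ∷ p) *ₚ (b ∷ q)) i ≡ coeff (scaleₚ b (a ∷ p) +ₚ shift ((a ∷ p) *ₚ q)) i
    coeffs zero = *-comm′ a b
    coeffs (suc i) = begin
      coeff (scaleₚ a q +ₚ (p *ₚ (b ∷ q))) i
        ≡⟨ coeff-+ₚ (scaleₚ a q) (p *ₚ (b ∷ q)) i ⟩
      coeff (scaleₚ a q) i ℤ.+ coeff (p *ₚ (b ∷ q)) i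
        ≡⟨ cong (λ r → coeff (scaleₚ a q) i ℤ.+ r) (coeff-≡ (*ₚ-∷ʳ p b q) i) ⟩
      coeff (scaleₚ a q) i ℤ.+ coeff (scaleₚ b p +ₚ shift (p *ₚ q)) i
        ≡⟨ cong (λ r → coeff (scaleₚ a q) i ℤ.+ r) (coeff-+ₚ (scaleₚ b p) (shift (p *ₚ q)) i) ⟩
      coeff (scaleₚ a q) i ℤ.+ (coeff (scaleₚ b p) i ℤ.+ coeff (shift (p *ₚ q)) i)
        ≡⟨ +-swapˡ (coeff (scaleₚ a q) i) (coeff (scaleₚ b p) i) (coeff (shift (p *ₚ q)) i) ⟩
      coeff (scaleₚ b p) i ℤ.+ (coeff (scaleₚ a q) i ℤ.+ coeff (shift (p *ₚ q)) i)
        ≡⟨ cong (λ r → coeff (scaleₚ b p) i ℤ.+ r) (coeff-+ₚ (scaleₚ a q) (shift (p *ₚ q)) i) ⟨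
      coeff (scaleₚ b p) i ℤ.+ coeff ((a ∷ p) *ₚ q) i
        ≡⟨ coeff-+ₚ (scaleₚ b p) ((a ∷ p) *ₚ q) i ⟨
      coeff (scaleₚ b p +ₚ ((a ∷ p) *ₚ q)) i ∎

  *ₚ-comm : ∀ p q → p *ₚ q ≈ₚ q *ₚ p
  *ₚ-comm [] q = ≈ₚ-sym (*ₚ-zeroʳ q)
  *ₚ-comm (a ∷ p) q = ≈ₚ-trans (+ₚ-cong ≈ₚ-refl (shift-cong (*ₚ-comm p q))) (≈ₚ-sym (*ₚ-∷ʳ q a p))

  *ₚ-congʳ : ∀ {p p′} q → p ≈ₚ p′ → p *ₚ q ≈ₚ p′ *ₚ q
  *ₚ-congʳ {p} {p′} q p≈p′ = ≈ₚ-trans (*ₚ-comm p q) (≈ₚ-trans (*ₚ-congˡ q p≈p′) (*ₚ-comm q p′))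

  *ₚ-cong : ∀ {p p′ q q′} → p ≈ₚ p′ → q ≈ₚ q′ → p *ₚ q ≈ₚ p′ *ₚ q′
  *ₚ-cong {p′ = p′} {q = q} p≈p′ q≈q′ = ≈ₚ-trans (*ₚ-congʳ q p≈p′) (*ₚ-congˡ p′ q≈q′)

  shift-*ₚ : ∀ p q → shift p *ₚ q ≈ₚ shift (p *ₚ q)
  shift-*ₚ p q = coeffwise λ i → begin
    coeff (shift p *ₚ q) i ≡⟨ coeff-∷*ₚ (+ 0) p q i ⟩
    + 0 ℤ.* coeff q i ℤ.+ coeff (shift (p *ₚ q)) i
      ≡⟨ cong (ℤ._+ coeff (shift (p *ₚ q)) i) (ℤ.*-zeroˡ (coeff q i)) ⟩
    + 0 ℤ.+ coeff (shift (p *ₚ q)) i ≡⟨ ℤ.+-identityˡ _ ⟩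
    coeff (shift (p *ₚ q)) i ∎

  *ₚ-distribʳ : ∀ r p q → (p +ₚ q) *ₚ r ≈ₚ (p *ₚ r) +ₚ (q *ₚ r)
  *ₚ-distribʳ r [] q = ≈ₚ-refl
  *ₚ-distribʳ r (a ∷ p) [] = ≈ₚ-sym (+ₚ-identityʳ _)
  *ₚ-distribʳ r (a ∷ p) (b ∷ q) = coeffwise λ i → begin
    coeff (((a ℤ.+ b) ∷ (p +ₚ q)) *ₚ r) i
      ≡⟨ coeff-∷*ₚ (a ℤ.+ b) (p +ₚ q) r i ⟩
    (a ℤ.+ b) ℤ.* coeff r i ℤ.+ coeff (shift ((p +ₚ q) *ₚ r)) i
      ≡⟨ cong (λ s → (a ℤ.+ b) ℤ.* coeff r i ℤ.+ s) (coeff-≡ (shift-cong (*ₚ-distribʳ r p q)) i) ⟩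
    (a ℤ.+ b) ℤ.* coeff r i ℤ.+ coeff (shift (p *ₚ r) +ₚ shift (q *ₚ r)) i
      ≡⟨ cong (λ s → (a ℤ.+ b) ℤ.* coeff r i ℤ.+ s) (coeff-+ₚ (shift (p *ₚ r)) (shift (q *ₚ r)) i) ⟩
    (a ℤ.+ b) ℤ.* coeff r i ℤ.+ (coeff (shift (p *ₚ r)) i ℤ.+ coeff (shift (q *ₚ r)) i)
      ≡⟨ distrib-interchange a b (coeff r i) _ _ ⟩
    (a ℤ.* coeff r i ℤ.+ coeff (shift (p *ₚ r)) i) ℤ.+ (b ℤ.* coeff r i ℤ.+ coeff (shift (q *ₚ r)) i)
      ≡⟨ cong₂ ℤ._+_ (coeff-∷*ₚ a p r i) (coeff-∷*ₚ b q r i) ⟨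
    coeff ((a ∷ p) *ₚ r) i ℤ.+ coeff ((b ∷ q) *ₚ r) i
      ≡⟨ coeff-+ₚ ((a ∷ p) *ₚ r) ((b ∷ q) *ₚ r) i ⟨
    coeff (((a ∷ p) *ₚ r) +ₚ ((b ∷ q) *ₚ r)) i ∎
    where
    distrib-interchange : ∀ a b c x y →
      (a ℤ.+ b) ℤ.* c ℤ.+ (x ℤ.+ y) ≡ (a ℤ.* c ℤ.+ x) ℤ.+ (b ℤ.* c ℤ.+ y)
    distrib-interchange = ℤ-Solver.solve-∀

  *ₚ-distribˡ : ∀ r p q → r *ₚ (p +ₚ q) ≈ₚ (r *ₚ p) +ₚ (r *ₚ q)
  *ₚ-distribˡ r p q =
    ≈ₚ-trans (*ₚ-comm r (p +ₚ q)) (≈ₚ-trans (*ₚ-distribʳ r p q) (+ₚ-cong (*ₚ-comm p r) (*ₚ-comm q r)))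

  scaleₚ-*ₚ : ∀ a q r → scaleₚ a q *ₚ r ≈ₚ scaleₚ a (q *ₚ r)
  scaleₚ-*ₚ a [] r = ≈ₚ-refl
  scaleₚ-*ₚ a (b ∷ q) r = coeffwise λ i → begin
    coeff ((a ℤ.* b ∷ scaleₚ a q) *ₚ r) i ≡⟨ coeff-∷*ₚ (a ℤ.* b) (scaleₚ a q) r i ⟩
    (a ℤ.* b) ℤ.* coeff r i ℤ.+ coeff (shift (scaleₚ a q *ₚ r)) i
      ≡⟨ cong (λ s → (a ℤ.* b) ℤ.* coeff r i ℤ.+ s) (coeff-≡ (shift-cong (scaleₚ-*ₚ a q r)) i) ⟩
    (a ℤ.* b) ℤ.* coeff r i ℤ.+ coeff (shift (scaleₚ a (q *ₚ r))) i
      ≡⟨ cong (λ s → (a ℤ.* b) ℤ.* coeff r i ℤ.+ s) (coeff-shift-scaleₚ (q *ₚ r) i) ⟩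
    (a ℤ.* b) ℤ.* coeff r i ℤ.+ a ℤ.* coeff (shift (q *ₚ r)) i
      ≡⟨ factor a b (coeff r i) _ ⟩
    a ℤ.* (b ℤ.* coeff r i ℤ.+ coeff (shift (q *ₚ r)) i)
      ≡⟨ cong (a ℤ.*_) (coeff-∷*ₚ b q r i) ⟨
    a ℤ.* coeff ((b ∷ q) *ₚ r) i ≡⟨ coeff-scaleₚ a ((b ∷ q) *ₚ r) i ⟨
    coeff (scaleₚ a ((b ∷ q) *ₚ r)) i ∎
    where
    factor : ∀ a b c x → (a ℤ.* b) ℤ.* c ℤ.+ a ℤ.* x ≡ a ℤ.* (b ℤ.* c ℤ.+ x)
    factor = ℤ-Solver.solve-∀
    coeff-shift-scaleₚ : ∀ t i → coeff (shift (scaleₚ a t)) i ≡ a ℤ.* coeff (shift t) i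
    coeff-shift-scaleₚ t zero = ≡.sym (ℤ.*-zeroʳ a)
    coeff-shift-scaleₚ t (suc i) = coeff-scaleₚ a t i

  *ₚ-assoc : ∀ p q r → (p *ₚ q) *ₚ r ≈ₚ p *ₚ (q *ₚ r)
  *ₚ-assoc [] q r = ≈ₚ-refl
  *ₚ-assoc (a ∷ p) q r = ≈ₚ-trans (*ₚ-distribʳ r (scaleₚ a q) (shift (p *ₚ q)))
    (+ₚ-cong (scaleₚ-*ₚ a q r) (≈ₚ-trans (shift-*ₚ (p *ₚ q) r) (shift-cong (*ₚ-assoc p q r))))

  1ₚ : Poly
  1ₚ = + 1 ∷ []

  *ₚ-identityˡ : ∀ p → 1ₚ *ₚ p ≈ₚ p
  *ₚ-identityˡ p = coeffwise λ i → begin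
    coeff (1ₚ *ₚ p) i ≡⟨ coeff-∷*ₚ (+ 1) [] p i ⟩
    + 1 ℤ.* coeff p i ℤ.+ coeff (shift []) i ≡⟨ cong₂ ℤ._+_ (ℤ.*-identityˡ (coeff p i)) (coeff-≡ shift-[] i) ⟩
    coeff p i ℤ.+ + 0 ≡⟨ ℤ.+-identityʳ (coeff p i) ⟩
    coeff p i ∎

  *ₚ-identityʳ : ∀ p → p *ₚ 1ₚ ≈ₚ p
  *ₚ-identityʳ p = ≈ₚ-trans (*ₚ-comm p 1ₚ) (*ₚ-identityˡ p)

  ℤ[x] : CommutativeRing 0ℓ 0ℓ
  ℤ[x] = record
    { isCommutativeRing = record
      { isRing = record
        { +-isAbelianGroup = record
          { isGroup = record
            { isMonoid = record
              { isSemigroup = record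
                { isMagma = record
                  { isEquivalence = record { refl = ≈ₚ-refl ; sym = ≈ₚ-sym ; trans = ≈ₚ-trans }
                  ; ∙-cong = +ₚ-cong }
                ; assoc = +ₚ-assoc }
              ; identity = (λ _ → ≈ₚ-refl) , +ₚ-identityʳ }
            ; inverse = negₚ-inverseˡ , negₚ-inverseʳ
            ; ⁻¹-cong = scaleₚ-cong (- + 1) }
          ; comm = +ₚ-comm }
        ; *-cong = *ₚ-cong
        ; *-assoc = *ₚ-assoc
        ; *-identity = *ₚ-identityˡ , *ₚ-identityʳ
        ; distrib = *ₚ-distribˡ , *ₚ-distribʳ }
      ; *-comm = *ₚ-comm } }

open Polynomial

module ℤ-Mat = LinearAlgebra ℤ.+-*-commutativeRing
module ℤ[x]-Mat = LinearAlgebra ℤ[x]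

open import Algebra.Properties.Semiring.Sum (CommutativeRing.semiring ℤ.+-*-commutativeRing)
  renaming (sum to ∑ℤ) using ()
open import Algebra.Properties.Semiring.Sum (CommutativeRing.semiring ℤ[x])
  renaming (sum to ∑ₚ; sum-cong-≋ to ∑ₚ-cong) using ()
open import Algebra.Properties.Semiring.Exp (CommutativeRing.semiring ℤ[x]) using (_^_)
open import Algebra.Properties.Semiring.Divisibility (CommutativeRing.semiring ℤ[x])
  using (_∣_; _,_; ∣ʳ-respʳ-≈)
open import Algebra.Properties.CommutativeSemigroup (CommutativeRing.*-commutativeSemigroup ℤ[x])
  using (x∙yz≈y∙xz)

X : Poly
X = + 0 ∷ + 1 ∷ []

constₚ : ℤ → Poly
constₚ a = a ∷ []

X*ₚ≈shift : ∀ p → X *ₚ p ≈ₚ shift p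
X*ₚ≈shift p = coeffwise λ i → ≡.trans (coeff-∷*ₚ (+ 0) (+ 1 ∷ []) p i)
  (≡.trans (cong (ℤ._+ coeff (shift (1ₚ *ₚ p)) i) (ℤ.*-zeroˡ (coeff p i)))
    (≡.trans (ℤ.+-identityˡ _) (coeff-≡ (shift-cong (*ₚ-identityˡ p)) i)))

X^m∣p⇒coeff≡0 : ∀ m {p} → X ^ m ∣ p → ∀ i → i < m → coeff p i ≡ + 0
X^m∣p⇒coeff≡0 (suc m) {p} (q , q*X^[1+m]≈p) i i<1+m = ≡.trans (coeff-≡ p≈shift i) (low i i<1+m)
  where
  p≈shift : p ≈ₚ shift (q *ₚ (X ^ m))
  p≈shift = ≈ₚ-sym (≈ₚ-trans (≈ₚ-sym (X*ₚ≈shift _))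
                             (≈ₚ-trans (≈ₚ-sym (x∙yz≈y∙xz q X (X ^ m))) q*X^[1+m]≈p))
  low : ∀ i → i < suc m → coeff (shift (q *ₚ (X ^ m))) i ≡ + 0
  low zero _ = refl
  low (suc i) (s≤s i<m) = X^m∣p⇒coeff≡0 m (q , ≈ₚ-refl) i i<m

mult0-≥ : ∀ m p → m ≤ length p → (∀ i → i < m → coeff p i ≡ + 0) → m ≤ mult0 p
mult0-≥ zero p _ _ = z≤n
mult0-≥ (suc m) (a ∷ p) (s≤s m≤∣p∣) low with a ℤ.≟ + 0
... | yes _ = s≤s (mult0-≥ m p m≤∣p∣ λ i i<m → low (suc i) (s≤s i<m))
... | no a≢0 = contradiction (low 0 (s≤s z≤n)) a≢0

length-+ₚˡ : ∀ p q → length p ≤ length (p +ₚ q)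
length-+ₚˡ [] q = z≤n
length-+ₚˡ (a ∷ p) [] = ℕ.≤-refl
length-+ₚˡ (a ∷ p) (b ∷ q) = s≤s (length-+ₚˡ p q)

length-+ₚʳ : ∀ p q → length q ≤ length (p +ₚ q)
length-+ₚʳ [] q = ℕ.≤-refl
length-+ₚʳ (a ∷ p) [] = z≤n
length-+ₚʳ (a ∷ p) (b ∷ q) = s≤s (length-+ₚʳ p q)

length-scaleₚ : ∀ c p → length (scaleₚ c p) ≡ length p
length-scaleₚ c p = List.length-map (c ℤ.*_) p

length-*ₚ : ∀ p q → 2 ≤ length p → suc (length q) ≤ length (p *ₚ q)
length-*ₚ (a ∷ b ∷ p) q _ = begin
  suc (length q) ≡⟨ cong suc (length-scaleₚ b q) ⟨
  suc (length (scaleₚ b q)) ≤⟨ s≤s (length-+ₚˡ (scaleₚ b q) (shift (p *ₚ q))) ⟩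
  length (shift ((b ∷ p) *ₚ q)) ≤⟨ length-+ₚʳ (scaleₚ a q) (shift ((b ∷ p) *ₚ q)) ⟩
  length ((a ∷ b ∷ p) *ₚ q) ∎
  where open ℕ.≤-Reasoning
length-*ₚ (a ∷ []) q (s≤s ())

length-det : ∀ n (M : Fin n → Fin n → Poly) → (∀ i → 2 ≤ length (M i i)) → suc n ≤ length (det n M)
length-det zero M _ = ℕ.≤-refl
length-det (suc n) M diagonal = begin
  suc (suc n) ≤⟨ s≤s (length-det n minor₀ (diagonal ∘ suc)) ⟩
  suc (length (det n minor₀)) ≤⟨ length-*ₚ (M zero zero) (det n minor₀) (diagonal zero) ⟩
  length (M zero zero *ₚ det n minor₀) ≡⟨ length-scaleₚ (+ 1) (M zero zero *ₚ det n minor₀) ⟨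
  length (scaleₚ (+ 1) (M zero zero *ₚ det n minor₀))
    ≤⟨ length-+ₚˡ (scaleₚ (+ 1) (M zero zero *ₚ det n minor₀)) _ ⟩
  length (det (suc n) M) ∎
  where
  open ℕ.≤-Reasoning
  minor₀ : Fin n → Fin n → Poly
  minor₀ i k = M (suc i) (suc k)

sgn≈constₚ : ∀ k → ℤ[x]-Mat.sgn k ≈ₚ constₚ (altSign k)
sgn≈constₚ zero = ≈ₚ-refl
sgn≈constₚ (suc zero) = coeffwise λ { zero → refl ; (suc i) → refl }
sgn≈constₚ (suc (suc k)) = sgn≈constₚ k

constₚ*ₚ≈scaleₚ : ∀ c p → constₚ c *ₚ p ≈ₚ scaleₚ c p
constₚ*ₚ≈scaleₚ c p = ≈ₚ-trans (+ₚ-cong ≈ₚ-refl shift-[]) (+ₚ-identityʳ (scaleₚ c p))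

foldr-map-tabulate : ∀ {k} m (f : Fin k → Poly) (g : Fin m → Fin k) →
  foldr _+ₚ_ [] (map f (tabulate g)) ≈ₚ ∑ₚ (f ∘ g)
foldr-map-tabulate zero f g = ≈ₚ-refl
foldr-map-tabulate (suc m) f g = +ₚ-cong ≈ₚ-refl (foldr-map-tabulate m f (g ∘ suc))

det≈det : ∀ n (M : Fin n → Fin n → Poly) → det n M ≈ₚ ℤ[x]-Mat.det M
det≈det zero M = ≈ₚ-refl
det≈det (suc n) M = ≈ₚ-trans (foldr-map-tabulate (suc n) term id) (∑ₚ-cong {x = term} λ j →
  ≈ₚ-trans (≈ₚ-sym (constₚ*ₚ≈scaleₚ (altSign (toℕ j)) _))
           (*ₚ-cong (≈ₚ-sym (sgn≈constₚ (toℕ j))) (*ₚ-congˡ (M zero j) (det≈det n _))))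
  where
  term : Fin (suc n) → Poly
  term j = scaleₚ (altSign (toℕ j)) (M zero j *ₚ det n (λ i k → M (suc i) (punchIn j k)))

charPoly-entry : ∀ (b : Bool) c →
  (if b then c ∷ + 1 ∷ [] else c ∷ []) ≈ₚ (X *ₚ (if b then 1ₚ else [])) +ₚ constₚ c
charPoly-entry true c = coeffwise λ where
  zero → ≡.sym (ℤ.+-identityˡ c)
  (suc zero) → refl
  (suc (suc i)) → refl
charPoly-entry false c = +ₚ-cong (≈ₚ-sym (*ₚ-zeroʳ X)) ≈ₚ-refl

const-∑ : ∀ m (f : Fin m → ℤ) → constₚ (∑ℤ f) ≈ₚ ∑ₚ (constₚ ∘ f)
const-∑ zero f = coeffwise λ { zero → refl ; (suc i) → refl }
const-∑ (suc m) f = +ₚ-cong ≈ₚ-refl (const-∑ m (f ∘ suc))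

const-* : ∀ a b → constₚ (a ℤ.* b) ≈ₚ constₚ a *ₚ constₚ b
const-* a b = ≈ₚ-sym (constₚ*ₚ≈scaleₚ a (constₚ b))

rankAtMost-const : ∀ {m p K} {N : Fin m → Fin p → ℤ} → ℤ-Mat.RankAtMost K N →
                   ℤ[x]-Mat.RankAtMost K (λ i j → constₚ (N i j))
rankAtMost-const {K = K} (u , v , N≈uv) = (λ t i → constₚ (u t i)) , (λ t j → constₚ (v t j)) , λ i j →
  ≈ₚ-trans (coeffwise λ k → cong (λ a → coeff (constₚ a) k) (N≈uv i j))
    (≈ₚ-trans (const-∑ K _) (∑ₚ-cong {x = λ t → constₚ (u t i ℤ.* v t j)} λ t → const-* (u t i) (v t j)))

-- mult0 counts leading zero coefficients of the list, so beyond divisibility by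
-- X ^ (n ∸ ρ) it needs the characteristic polynomial to have enough coefficients.
eigMult0-≥ : ∀ n (A : Fin n → Fin n → ℤ) {ρ} → ℤ-Mat.RankAtMost ρ A → n ∸ ρ ≤ eigMult0 n A
eigMult0-≥ n A {ρ} rankA = mult0-≥ (n ∸ ρ) (charPoly n A)
  (ℕ.≤-trans (ℕ.m∸n≤m n ρ) (ℕ.≤-trans (ℕ.n≤1+n n) (length-det n xI-A diagonal)))
  (X^m∣p⇒coeff≡0 (n ∸ ρ) (∣ʳ-respʳ-≈ (≈ₚ-sym (det≈det n xI-A))
    (ℤ[x]-Mat.LowRankPerturbation.x^[n∸ρ]∣det X rank-A λ i j → charPoly-entry (does (i Fin.≟ j)) (- A i j))))
  where
  xI-A : Fin n → Fin n → Poly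
  xI-A i j = if does (i Fin.≟ j) then (- A i j) ∷ + 1 ∷ [] else (- A i j) ∷ []
  diagonal : ∀ i → 2 ≤ length (xI-A i i)
  diagonal i with i Fin.≟ i
  ... | yes _ = s≤s (s≤s z≤n)
  ... | no i≢i = contradiction refl i≢i
  rank-A : ℤ[x]-Mat.RankAtMost ρ (λ i j → constₚ (- A i j))
  rank-A = rankAtMost-const (ℤ-Mat.rankAtMost-cong (λ i j → ℤ.-1*i≡-i (A i j)) (ℤ-Mat.rankAtMost-* (- + 1) rankA))

signMatrix : ∀ {p q} → SignedKpq p q → Fin p → Fin q → ℤ
signMatrix σ a b = signVal (σ a b)

adjacency≡bipartite : ∀ {p q} (σ : SignedKpq p q) i j →
  adjacency σ i j ≡ ℤ-Mat.bipartite (signMatrix σ) (Fin.splitAt p i) (Fin.splitAt p j)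
adjacency≡bipartite {p} σ i j = adjBip≡bipartite (Fin.splitAt p i) (Fin.splitAt p j)
  where
  adjBip≡bipartite : ∀ s₁ s₂ → adjBip σ s₁ s₂ ≡ ℤ-Mat.bipartite (signMatrix σ) s₁ s₂
  adjBip≡bipartite (inj₁ _) (inj₁ _) = refl
  adjBip≡bipartite (inj₁ _) (inj₂ _) = refl
  adjBip≡bipartite (inj₂ _) (inj₁ _) = refl
  adjBip≡bipartite (inj₂ _) (inj₂ _) = refl

negativity : Sign → ℤ
negativity pos = + 0
negativity neg = + 1

signVal≡1-2*negativity : ∀ s → signVal s ≡ + 1 ℤ.* + 1 ℤ.+ - + 2 ℤ.* negativity s
signVal≡1-2*negativity pos = refl
signVal≡1-2*negativity neg = refl

signMatrix-rankAtMost-suc : ∀ {p q K} (σ : SignedKpq p q) → ℤ-Mat.RankAtMost K (λ a b → negativity (σ a b)) →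
                            ℤ-Mat.RankAtMost (suc K) (signMatrix σ)
signMatrix-rankAtMost-suc σ rankN =
  ℤ-Mat.rankAtMost-cong (λ a b → ≡.sym (signVal≡1-2*negativity (σ a b)))
    (ℤ-Mat.rankAtMost-+ (ℤ-Mat.rankAtMost-outer (λ _ → + 1) (λ _ → + 1)) (ℤ-Mat.rankAtMost-* (- + 2) rankN))

module _ {p q} {σ : SignedKpq p q} {Ur : Subset p} {Vs : Subset q} (negInside : ContainsAllNeg σ Ur Vs) where

  negativity-outsideRows : ∀ a b → a ∉ Ur → negativity (σ a b) ≡ + 0
  negativity-outsideRows a b a∉Ur with σ a b in σab
  ... | pos = refl
  ... | neg = contradiction (proj₁ (negInside a b σab)) a∉Ur

  negativity-outsideColumns : ∀ a b → b ∉ Vs → negativity (σ a b) ≡ + 0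
  negativity-outsideColumns a b b∉Vs with σ a b in σab
  ... | pos = refl
  ... | neg = contradiction (proj₂ (negInside a b σab)) b∉Vs

  signMatrix-rankAtMost : ℤ-Mat.RankAtMost (suc (∣ Ur ∣ ⊓ ∣ Vs ∣)) (signMatrix σ)
  signMatrix-rankAtMost with ℕ.⊓-sel ∣ Ur ∣ ∣ Vs ∣
  ... | inj₁ r⊓s≡r = ≡.subst (λ k → ℤ-Mat.RankAtMost (suc k) (signMatrix σ)) (≡.sym r⊓s≡r)
        (signMatrix-rankAtMost-suc σ (ℤ-Mat.rankAtMost-rows Ur negativity-outsideRows))
  ... | inj₂ r⊓s≡s = ≡.subst (λ k → ℤ-Mat.RankAtMost (suc k) (signMatrix σ)) (≡.sym r⊓s≡s)
        (signMatrix-rankAtMost-suc σ (ℤ-Mat.rankAtMost-columns Vs negativity-outsideColumns))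

theorem3p1 : (p q : ℕ) → p ≤ q → (σ : SignedKpq p q) →
    (Ur : Subset p) (Vs : Subset q) →
    ContainsAllNeg σ Ur Vs →
    ((U′ : Subset p) (V′ : Subset q) → ContainsAllNeg σ U′ V′ →
    ∣ Ur ∣ + ∣ Vs ∣ ≤ ∣ U′ ∣ + ∣ V′ ∣) →
    p + q ∸ 2 * (∣ Ur ∣ ⊓ ∣ Vs ∣) ∸ 2 ≤ eigMult0 (p + q) (adjacency σ)
theorem3p1 p q _ σ Ur Vs negInside _ = begin
  p + q ∸ 2 * k ∸ 2 ≡⟨ ℕ.∸-+-assoc (p + q) (2 * k) 2 ⟩
  p + q ∸ (2 * k + 2) ≡⟨ cong (p + q ∸_) (double k) ⟩
  p + q ∸ (suc k + suc k) ≤⟨ eigMult0-≥ (p + q) (adjacency σ) rankA ⟩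
  eigMult0 (p + q) (adjacency σ) ∎
  where
  open ℕ.≤-Reasoning
  k = ∣ Ur ∣ ⊓ ∣ Vs ∣
  double : ∀ k → 2 * k + 2 ≡ suc k + suc k
  double = ℕ-Solver.solve-∀
  rankA : ℤ-Mat.RankAtMost (suc k + suc k) (adjacency σ)
  rankA = ℤ-Mat.rankAtMost-cong (λ i j → ≡.sym (adjacency≡bipartite σ i j))
            (ℤ-Mat.rankAtMost-bipartite (signMatrix-rankAtMost negInside))
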